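{- Let $G$ be a signed graph with vertex set $V$, let $u_1\neq u_2$ and $w_1\neq w_2$ be vertices, let $F$ be a Tutte-$2$-arborescence for $[u_1u_2,w_1w_2]$ and let $c_F\in\widehat{\mathfrak{C}}^1_{\neq0}(L^0(G);u_1u_2,w_1w_2)$ be its corresponding reduced contributor (defined below). Then (1) $\mathrm{sgn}_T(F)=+1$ if and only if $\check c_F$ has exactly two cycles, and (2) $\mathrm{sgn}_T(F)=-1$ if and only if $\check c_F$ has exactly one cycle.
   Context: An oriented hypergraph $G$ consists of finite sets $V$, $E$, $I$ (incidences), maps $\varsigma:I\to V$, $\omega:I\to E$, and $\sigma:I\to\{\pm1\}$. An adjacency is an ordered pair $(i,j)$ of distinct incidences on the same edge, from $\varsigma(i)$ to $\varsigma(j)$; a backstep at $v$ is the step $v,i,\omega(i),i,v$ with $\varsigma(i)=v$. A signed graph (bidirected graph) is one where every edge has exactly two incidences. A Tutte-$2$-arborescence for $[u_1u_2,w_1w_2]$ is a spanning forest $F$ of the underlying graph with exactly two components, one containing $u_1$ and the other $u_2$, such that either ($u_1,w_1$ together and $u_2,w_2$ together), in which case $\mathrm{sgn}_T(F)=+1$, or ($u_1,w_2$ together and $u_2,w_1$ together), in which case $\mathrm{sgn}_T(F)=-1$. The set $\widehat{\mathfrak{C}}_{\neq0}(L^0(G);u_1u_2,w_1w_2)$ consists of assignments $c$ choosing, for each $v\in V\setminus\{u_1,u_2\}$, an adjacency of $G$ starting at $v$ or a backstep at $v$, such that $\pi_c:V\to V$, with $\pi_c(v)$ the head of the step at $v$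 and $\pi_c(u_i)=w_i$, is a bijection; $\check c$ is $c$ together with the formal arcs $u_1\to w_1$, $u_2\to w_2$. The corresponding reduced contributor $c_F$: each component of $F$ contains exactly one $w\in\{w_1,w_2\}$ and one $u\in\{u_1,u_2\}$; for a vertex $v\notin\{u_1,u_2\}$ lying on the $F$-path from such $w$ to such $u$, $c_F$ uses the adjacency along the $F$-edge from $v$ to the next vertex of that path toward $u$; for any other vertex $v$, $c_F$ uses the backstep at $v$ on the incidence at $v$ of the first edge of the $F$-path from $v$ to that $w$–$u$ path. Here a cycle of $\check c_F$ means a cycle of $\pi_{c_F}$ containing a formal arc $u_i\to w_i$ (i.e., not a backstep). $\widehat{\mathfrak{C}}^1_{\neq0}$ denotes the elements lying in single-element tail-equivalence classes (tail-equivalence: same tail incidence at every $v\notin\{u_1,u_2\}$). -}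

module Defs where

open import Data.Nat using (ℕ; zero; suc)
open import Data.Fin using (Fin; zero; suc; _≟_)
open import Data.Fin.Subset using (Subset; _∈_)
open import Data.Sign using (Sign; +; -)
open import Data.Product using (Σ; ∃; _×_; _,_)
open import Data.Sum using (_⊎_)
open import Data.List using (List; []; _∷_)
open import Data.List.Relation.Unary.All using (All)
open import Data.List.Relation.Unary.Unique.Propositional using (Unique)
import Data.List.Membership.Propositional as LM
open import Relation.Binary.PropositionalEquality using (_≡_; _≢_)
open import Relation.Nullary using (¬_; yes; no)
open import Function.Definitions using (Bijective)

-- Signed graphs (bidirected graphs): oriented hypergraphs in which every
-- edge has exactly two incidences.  We take V = Fin n, E = Fin m and the
-- incidence set I = E × Fin 2 (incidence (e , d) is the d-th end of e),
-- so ω (e , d) = e, ς (e , d) = ends e d, σ (e , d) = sgn e d.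

record SignedGraph (n m : ℕ) : Set where
  field
    ends : Fin m → Fin 2 → Fin n
    sgn  : Fin m → Fin 2 → Sign

other : Fin 2 → Fin 2
other zero = suc zero
other (suc zero) = zero

iter : {A : Set} → (A → A) → ℕ → A → A
iter f zero x = x
iter f (suc k) x = f (iter f k x)

module _ {n m : ℕ} (G : SignedGraph n m) where
  open SignedGraph G

  data Walk (F : Subset m) : Fin n → Fin n → Set where
    nil  : ∀ {x} → Walk F x x
    cons : ∀ {x y} (e : Fin m) (d : Fin 2) → e ∈ F → ends e d ≡ x →
           Walk F (ends e (other d)) y → Walk F x y

  verts : ∀ {F x y} → Walk F x y → List (Fin n)
  verts {x = x} nil = x ∷ []
  verts {x = x} (cons e d _ _ w) = x ∷ verts w

  edges : ∀ {F x y} → Walk F x y → List (Fin m)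
  edges nil = []
  edges (cons e d _ _ w) = e ∷ edges w

  IsPath : ∀ {F x y} → Walk F x y → Set
  IsPath w = Unique (verts w)

  Connected : Subset m → Fin n → Fin n → Set
  Connected F x y = Walk F x y

  data StepAt {F : Subset m} : ∀ {x y} → Walk F x y → Fin n → Fin m → Fin 2 → Set where
    here  : ∀ {x y e d p q} {w : Walk F (ends e (other d)) y} →
            StepAt (cons {x = x} e d p q w) x e d
    there : ∀ {x y e' d' p q v e d} {w : Walk F (ends e' (other d')) y} →
            StepAt w v e d → StepAt (cons {x = x} e' d' p q w) v e d

  data FirstStep {F : Subset m} : ∀ {x y} → Walk F x y → Fin m → Fin 2 → Set where
    first : ∀ {x y e d p q} {w : Walk F (ends e (other d)) y} →
            FirstStep (cons {x = x} e d p q w) e d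

  -- a cycle in F: an edge e ∈ F together with a path between its two ends
  -- not using e (a loop is a cycle with the trivial path)
  HasCycle : Subset m → Set
  HasCycle F = Σ (Fin m) λ e → e ∈ F ×
                 Σ (Walk F (ends e (other zero)) (ends e zero)) λ P →
                   IsPath P × All (λ e' → e' ≢ e) (edges P)

  IsForest : Subset m → Set
  IsForest F = ¬ HasCycle F

  TwoComponentForest : Fin n → Fin n → Subset m → Set
  TwoComponentForest u₁ u₂ F =
    IsForest F × ¬ Connected F u₁ u₂ ×
    (∀ v → Connected F v u₁ ⊎ Connected F v u₂)

  data SgnT (F : Subset m) (u₁ u₂ w₁ w₂ : Fin n) : Sign → Set where
    pos : Connected F u₁ w₁ → Connected F u₂ w₂ → SgnT F u₁ u₂ w₁ w₂ +
    neg : Connected F u₁ w₂ → Connected F u₂ w₁ → SgnT F u₁ u₂ w₁ w₂ -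

  Tutte2Arb : Fin n → Fin n → Fin n → Fin n → Subset m → Set
  Tutte2Arb u₁ u₂ w₁ w₂ F =
    TwoComponentForest u₁ u₂ F × ∃ λ s → SgnT F u₁ u₂ w₁ w₂ s

  -- a step of G: the adjacency from incidence (e , d) to (e , other d),
  -- or the backstep on incidence (e , d)
  data GStep : Set where
    adj  : Fin m → Fin 2 → GStep
    back : Fin m → Fin 2 → GStep

  tailInc : GStep → Fin m × Fin 2
  tailInc (adj e d) = e , d
  tailInc (back e d) = e , d

  tailV : GStep → Fin n
  tailV (adj e d) = ends e d
  tailV (back e d) = ends e d

  headV : GStep → Fin n
  headV (adj e d) = ends e (other d)
  headV (back e d) = ends e d

  -- an assignment: c v is only meaningful for v ∉ {u₁,u₂}
  Assignment : Set
  Assignment = Fin n → GStep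

  IsAssignment : Fin n → Fin n → Assignment → Set
  IsAssignment u₁ u₂ c = ∀ v → v ≢ u₁ → v ≢ u₂ → tailV (c v) ≡ v

  π : Fin n → Fin n → Fin n → Fin n → Assignment → Fin n → Fin n
  π u₁ u₂ w₁ w₂ c v with v ≟ u₁
  ... | yes _ = w₁
  ... | no _ with v ≟ u₂
  ...   | yes _ = w₂
  ...   | no _ = headV (c v)

  InC : Fin n → Fin n → Fin n → Fin n → Assignment → Set
  InC u₁ u₂ w₁ w₂ c =
    IsAssignment u₁ u₂ c × Bijective _≡_ _≡_ (π u₁ u₂ w₁ w₂ c)

  -- equality of assignments (they only matter off {u₁,u₂})
  SameAssignment : Fin n → Fin n → Assignment → Assignment → Set
  SameAssignment u₁ u₂ c c' = ∀ v → v ≢ u₁ → v ≢ u₂ → c v ≡ c' v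

  TailEquiv : Fin n → Fin n → Assignment → Assignment → Set
  TailEquiv u₁ u₂ c c' =
    ∀ v → v ≢ u₁ → v ≢ u₂ → tailInc (c v) ≡ tailInc (c' v)

  -- membership in Ĉ¹_{≠0}: single-element tail-equivalence class
  InC1 : Fin n → Fin n → Fin n → Fin n → Assignment → Set
  InC1 u₁ u₂ w₁ w₂ c =
    InC u₁ u₂ w₁ w₂ c ×
    (∀ c' → InC u₁ u₂ w₁ w₂ c' → TailEquiv u₁ u₂ c c' → SameAssignment u₁ u₂ c c')

  -- The reduced contributor c_F (specified relationally; it is unique
  -- since F-paths are unique in a forest).

  CFAt : Subset m → Fin n → Fin n → Fin n → GStep → Set
  CFAt F v w u s =
    ∀ (P : Walk F w u) → IsPath P →
      -- v on the path: adjacency along the next F-edge towards u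
      ((v LM.∈ verts P) → ∀ e d → StepAt P v e d → s ≡ adj e d) ×
      -- v off the path: backstep on the first edge of the F-path from v
      -- to the w–u path
      (¬ (v LM.∈ verts P) →
        ∀ x (Q : Walk F v x) → IsPath Q → x LM.∈ verts P →
          (∀ y → y LM.∈ verts Q → y LM.∈ verts P → y ≡ x) →
          ∀ e d → FirstStep Q e d → s ≡ back e d)

  IsReducedContributor : Fin n → Fin n → Fin n → Fin n → Subset m →
                         Assignment → Set
  IsReducedContributor u₁ u₂ w₁ w₂ F c =
    ∀ v → v ≢ u₁ → v ≢ u₂ →
      ∀ w → (w ≡ w₁ ⊎ w ≡ w₂) → ∀ u → (u ≡ u₁ ⊎ u ≡ u₂) →
        Connected F v u → Connected F w u → CFAt F v w u (c v)

  -- Cycles of č: cycles (orbits) of π_c containing a formal arc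
  -- u_i → w_i.  "č has exactly k cycles": there are k pairwise distinct
  -- such cycles (given by representatives among u₁,u₂) and every formal
  -- arc lies on one of them.

  SameCycle : (Fin n → Fin n) → Fin n → Fin n → Set
  SameCycle p x y = ∃ λ k → iter p k x ≡ y

  HasFormalCycles : Fin n → Fin n → Fin n → Fin n → Assignment → ℕ → Set
  HasFormalCycles u₁ u₂ w₁ w₂ c k =
    let p = π u₁ u₂ w₁ w₂ c in
    Σ (Fin k → Fin n) λ r →
      (∀ i → r i ≡ u₁ ⊎ r i ≡ u₂) ×
      (∀ i j → SameCycle p (r i) (r j) → i ≡ j) ×
      (∀ u → (u ≡ u₁ ⊎ u ≡ u₂) → ∃ λ i → SameCycle p (r i) u)

-- Along the F-path from w ∈ {w₁, w₂} to u ∈ {u₁, u₂}, the reduced contributor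
-- c_F takes the adjacencies of the path, so π = π_{c_F} runs from w to u along
-- that path, and the formal arc u ↦ w closes the run into a cycle.  If
-- sgn_T F = +1, the runs w₁ ⇝ u₁ and w₂ ⇝ u₂ stay in different components of
-- F, so u₁ and u₂ lie on two different cycles of π.  If sgn_T F = −1, the runs
-- w₁ ⇝ u₂ and w₂ ⇝ u₁ splice with the two formal arcs into a single cycle.
module Submission where

open import Defs
open import Data.Nat using (ℕ; zero; suc)
open import Data.Fin using (Fin; zero; suc; _≟_)
open import Data.Fin.Subset using (Subset) renaming (_∈_ to _∈ˢ_)
open import Data.Sign using (+; -)
open import Data.Product using (_×_; Σ; ∃; _,_; proj₁; proj₂)
open import Data.Sum using (_⊎_; inj₁; inj₂)
open import Data.Empty using (⊥-elim)
open import Data.List.Membership.Propositional using (_∈_)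
import Data.List.Membership.DecPropositional as DecMembership
open import Data.List.Relation.Unary.All using ([]; lookup)
open import Data.List.Relation.Unary.All.Properties using (¬Any⇒All¬)
open import Data.List.Relation.Unary.Any using (here; there)
open import Data.List.Relation.Unary.AllPairs using ([]; _∷_)
open import Function.Base using (_∘_)
open import Function.Bundles using (_⇔_; mk⇔)
open import Relation.Binary.PropositionalEquality using (_≡_; _≢_; refl; sym; trans; cong; subst)
open import Relation.Nullary using (¬_; yes; no)

iter-suc : ∀ {A : Set} (f : A → A) k x → iter f (suc k) x ≡ iter f k (f x)
iter-suc f zero x = refl
iter-suc f (suc k) x = cong f (iter-suc f k x)

reaches-pred : ∀ {A : Set} {f : A → A} {a x u} →
               f a ≡ x → (∃ λ k → iter f k x ≡ u) → ∃ λ k → iter f k a ≡ u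
reaches-pred {f = f} {a} fa≡x (k , eq) = suc k , trans (iter-suc f k a) (trans (cong (iter f k) fa≡x) eq)

data Run {A : Set} (f : A → A) (Q : A → Set) : A → A → Set where
  stop : ∀ {u} → Q u → Run f Q u u
  step : ∀ {x u} → Q x → Run f Q (f x) u → Run f Q x u

module _ {A : Set} {f : A → A} {Q : A → Set} where

  Run-source : ∀ {x u} → Run f Q x u → Q x
  Run-source (stop q) = q
  Run-source (step q _) = q

  Run-target : ∀ {x u} → Run f Q x u → Q u
  Run-target (stop q) = q
  Run-target (step _ r) = Run-target r

  Run⇒reaches : ∀ {x u} → Run f Q x u → ∃ λ k → iter f k x ≡ u
  Run⇒reaches (stop _) = 0 , refl
  Run⇒reaches (step _ r) = reaches-pred refl (Run⇒reaches r)

  closed-run-orbit : ∀ {w u} → Run f Q w u → f u ≡ w → ∀ k → Q (iter f k u)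
  closed-run-orbit {u = u} R fu≡w = orbit (stop (Run-target R))
    where
      orbit : ∀ {x} → Run f Q x u → ∀ k → Q (iter f k x)
      orbit R′ zero = Run-source R′
      orbit (stop _) (suc k) =
        subst Q (sym (trans (iter-suc f k u) (cong (iter f k) fu≡w))) (orbit R k)
      orbit {x} (step _ r) (suc k) = subst Q (sym (iter-suc f k x)) (orbit r k)

other-involutive : ∀ d → other (other d) ≡ d
other-involutive zero = refl
other-involutive (suc zero) = refl

module Walks {n m : ℕ} (G : SignedGraph n m) (F : Subset m) where
  open SignedGraph G
  open DecMembership (_≟_ {n}) using (_∈?_)

  snoc : ∀ {x y z} → Walk G F x y → ∀ e d → e ∈ˢ F → ends e d ≡ y → ends e (other d) ≡ z →
         Walk G F x z
  snoc nil e d e∈F q refl = cons e d e∈F q nil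
  snoc (cons e′ d′ e′∈F q′ W) e d e∈F q r = cons e′ d′ e′∈F q′ (snoc W e d e∈F q r)

  reverse : ∀ {x y} → Walk G F x y → Walk G F y x
  reverse nil = nil
  reverse (cons e d e∈F q W) =
    snoc (reverse W) e (other d) e∈F refl (trans (cong (ends e) (other-involutive d)) q)

  last∈verts : ∀ {x y} (W : Walk G F x y) → y ∈ verts G W
  last∈verts nil = here refl
  last∈verts (cons _ _ _ _ W) = there (last∈verts W)

  StepAt⇒∈verts : ∀ {x y v e d} {W : Walk G F x y} → StepAt G W v e d → v ∈ verts G W
  StepAt⇒∈verts here = here refl
  StepAt⇒∈verts (there s) = there (StepAt⇒∈verts s)

  suffix : ∀ {x y v} (P : Walk G F x y) → IsPath G P → v ∈ verts G P →
           Σ (Walk G F v y) (IsPath G)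
  suffix nil P-path (here refl) = nil , P-path
  suffix (cons e d e∈F q P) P-path (here refl) = cons e d e∈F q P , P-path
  suffix (cons _ _ _ _ P) (_ ∷ P-path) (there v∈P) = suffix P P-path v∈P

  walk⇒path : ∀ {x y} → Walk G F x y → Σ (Walk G F x y) (IsPath G)
  walk⇒path nil = nil , ([] ∷ [])
  walk⇒path {x} (cons e d e∈F q W) with walk⇒path W
  ... | P , P-path with x ∈? verts G P
  ...   | yes x∈P = suffix P P-path x∈P
  ...   | no x∉P = cons e d e∈F q P , (¬Any⇒All¬ _ x∉P ∷ P-path)

module FormalCycles {n m : ℕ} (G : SignedGraph n m) (u₁ u₂ w₁ w₂ : Fin n) (c : Assignment G) where
  πc : Fin n → Fin n
  πc = π G u₁ u₂ w₁ w₂ c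

  π-u₁ : πc u₁ ≡ w₁
  π-u₁ with u₁ ≟ u₁
  ... | yes _ = refl
  ... | no u₁≢u₁ = ⊥-elim (u₁≢u₁ refl)

  π-u₂ : u₁ ≢ u₂ → πc u₂ ≡ w₂
  π-u₂ u₁≢u₂ with u₂ ≟ u₁
  ... | yes u₂≡u₁ = ⊥-elim (u₁≢u₂ (sym u₂≡u₁))
  ... | no _ with u₂ ≟ u₂
  ...   | yes _ = refl
  ...   | no u₂≢u₂ = ⊥-elim (u₂≢u₂ refl)

  π-inner : ∀ {x} → x ≢ u₁ → x ≢ u₂ → πc x ≡ headV G (c x)
  π-inner {x} x≢u₁ x≢u₂ with x ≟ u₁
  ... | yes x≡u₁ = ⊥-elim (x≢u₁ x≡u₁)
  ... | no _ with x ≟ u₂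
  ...   | yes x≡u₂ = ⊥-elim (x≢u₂ x≡u₂)
  ...   | no _ = refl

  Separated : Set
  Separated = ¬ SameCycle G πc u₁ u₂ × ¬ SameCycle G πc u₂ u₁

  Joined : Set
  Joined = SameCycle G πc u₁ u₂ × SameCycle G πc u₂ u₁

  separated⇒two : Separated → HasFormalCycles G u₁ u₂ w₁ w₂ c 2
  separated⇒two (u₁↛u₂ , u₂↛u₁) = r , r-formal , r-distinct , r-covers
    where
      r : Fin 2 → Fin n
      r zero = u₁
      r (suc zero) = u₂
      r-formal : ∀ i → r i ≡ u₁ ⊎ r i ≡ u₂
      r-formal zero = inj₁ refl
      r-formal (suc zero) = inj₂ refl
      r-distinct : ∀ i j → SameCycle G πc (r i) (r j) → i ≡ j
      r-distinct zero zero _ = refl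
      r-distinct zero (suc zero) u₁→u₂ = ⊥-elim (u₁↛u₂ u₁→u₂)
      r-distinct (suc zero) zero u₂→u₁ = ⊥-elim (u₂↛u₁ u₂→u₁)
      r-distinct (suc zero) (suc zero) _ = refl
      r-covers : ∀ u → u ≡ u₁ ⊎ u ≡ u₂ → ∃ λ i → SameCycle G πc (r i) u
      r-covers _ (inj₁ refl) = zero , 0 , refl
      r-covers _ (inj₂ refl) = suc zero , 0 , refl

  separated⇒¬one : Separated → ¬ HasFormalCycles G u₁ u₂ w₁ w₂ c 1
  separated⇒¬one (u₁↛u₂ , u₂↛u₁) (r , r-formal , _ , r-covers)
    with r-covers u₁ (inj₁ refl) | r-covers u₂ (inj₂ refl) | r-formal zero
  ... | zero , r₀→u₁ | zero , r₀→u₂ | inj₁ refl = u₁↛u₂ r₀→u₂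
  ... | zero , r₀→u₁ | zero , r₀→u₂ | inj₂ refl = u₂↛u₁ r₀→u₁

  joined⇒one : Joined → HasFormalCycles G u₁ u₂ w₁ w₂ c 1
  joined⇒one (u₁→u₂ , _) = (λ _ → u₁) , (λ _ → inj₁ refl) , one-class , covers
    where
      one-class : ∀ (i j : Fin 1) → SameCycle G πc u₁ u₁ → i ≡ j
      one-class zero zero _ = refl
      covers : ∀ u → u ≡ u₁ ⊎ u ≡ u₂ → ∃ λ (i : Fin 1) → SameCycle G πc u₁ u
      covers _ (inj₁ refl) = zero , 0 , refl
      covers _ (inj₂ refl) = zero , u₁→u₂

  joined⇒¬two : Joined → ¬ HasFormalCycles G u₁ u₂ w₁ w₂ c 2
  joined⇒¬two (u₁→u₂ , u₂→u₁) (r , r-formal , r-distinct , _)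
    with r-distinct zero (suc zero) (formal-linked (r-formal zero) (r-formal (suc zero)))
    where
      formal-linked : ∀ {a b} → a ≡ u₁ ⊎ a ≡ u₂ → b ≡ u₁ ⊎ b ≡ u₂ → SameCycle G πc a b
      formal-linked (inj₁ refl) (inj₁ refl) = 0 , refl
      formal-linked (inj₁ refl) (inj₂ refl) = u₁→u₂
      formal-linked (inj₂ refl) (inj₁ refl) = u₂→u₁
      formal-linked (inj₂ refl) (inj₂ refl) = 0 , refl
  ... | ()

module ReducedContributor {n m : ℕ} (G : SignedGraph n m) (F : Subset m) (u₁ u₂ w₁ w₂ : Fin n)
         (c : Assignment G) (c-is-cF : IsReducedContributor G u₁ u₂ w₁ w₂ F c)
         (u₁≢u₂ : u₁ ≢ u₂) (u₁≁u₂ : ¬ Walk G F u₁ u₂) where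
  open Walks G F
  open FormalCycles G u₁ u₂ w₁ w₂ c

  -- The component of u contains no other terminal, so c is constrained by c_F there.
  inner-in-component : ∀ {u x} → u ≡ u₁ ⊎ u ≡ u₂ → Walk G F x u → x ≢ u → x ≢ u₁ × x ≢ u₂
  inner-in-component (inj₁ refl) x~u₁ x≢u₁ = x≢u₁ , λ { refl → u₁≁u₂ (reverse x~u₁) }
  inner-in-component (inj₂ refl) x~u₂ x≢u₂ = (λ { refl → u₁≁u₂ x~u₂ }) , x≢u₂

  π-runs-along-path : ∀ {w u} → w ≡ w₁ ⊎ w ≡ w₂ → u ≡ u₁ ⊎ u ≡ u₂ →
                      (P : Walk G F w u) → IsPath G P → Run πc (λ x → Walk G F x u) w u
  π-runs-along-path {w} {u} w-formal u-formal P P-path = follow P P-path (λ s → s)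
    where
      follow : ∀ {x} (S : Walk G F x u) → IsPath G S →
               (∀ {v e d} → StepAt G S v e d → StepAt G P v e d) → Run πc (λ y → Walk G F y u) x u
      follow nil _ _ = stop nil
      follow {x} S@(cons e d _ _ S′) (x∉S′ ∷ S′-path) S⊆P =
        step S (subst (λ y → Run πc (λ z → Walk G F z u) y u) (sym π-x) (follow S′ S′-path (S⊆P ∘ there)))
        where
          x-inner : x ≢ u₁ × x ≢ u₂
          x-inner = inner-in-component u-formal S (lookup x∉S′ (last∈verts S′))
          c-x : c x ≡ adj e d
          c-x = proj₁ (c-is-cF x (proj₁ x-inner) (proj₂ x-inner) w w-formal u u-formal S P P P-path)
                      (StepAt⇒∈verts (S⊆P here)) e d (S⊆P here)
          π-x : πc x ≡ SignedGraph.ends G e (other d)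
          π-x = trans (π-inner (proj₁ x-inner) (proj₂ x-inner)) (cong (headV G) c-x)

  formal-arc-reaches : ∀ {a w u} → w ≡ w₁ ⊎ w ≡ w₂ → u ≡ u₁ ⊎ u ≡ u₂ →
                       πc a ≡ w → Walk G F u w → SameCycle G πc a u
  formal-arc-reaches w-formal u-formal πa≡w u~w with walk⇒path (reverse u~w)
  ... | P , P-path = reaches-pred πa≡w (Run⇒reaches (π-runs-along-path w-formal u-formal P P-path))

  cycle-in-component : ∀ {w u y} → w ≡ w₁ ⊎ w ≡ w₂ → u ≡ u₁ ⊎ u ≡ u₂ →
                       πc u ≡ w → Walk G F u w → SameCycle G πc u y → Walk G F y u
  cycle-in-component w-formal u-formal πu≡w u~w (k , u↦y) with walk⇒path (reverse u~w)
  ... | P , P-path =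
    subst (λ y → Walk G F y _) u↦y
          (closed-run-orbit (π-runs-along-path w-formal u-formal P P-path) πu≡w k)

  positive⇒separated : SgnT G F u₁ u₂ w₁ w₂ + → Separated
  positive⇒separated (pos u₁~w₁ u₂~w₂) =
      (λ u₁→u₂ → u₁≁u₂ (reverse (cycle-in-component (inj₁ refl) (inj₁ refl) π-u₁ u₁~w₁ u₁→u₂)))
    , (λ u₂→u₁ → u₁≁u₂ (cycle-in-component (inj₂ refl) (inj₂ refl) (π-u₂ u₁≢u₂) u₂~w₂ u₂→u₁))

  negative⇒joined : SgnT G F u₁ u₂ w₁ w₂ - → Joined
  negative⇒joined (neg u₁~w₂ u₂~w₁) =
      formal-arc-reaches (inj₁ refl) (inj₂ refl) π-u₁ u₂~w₁
    , formal-arc-reaches (inj₂ refl) (inj₁ refl) (π-u₂ u₁≢u₂) u₁~w₂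

  two⇒positive : ∀ {s} → SgnT G F u₁ u₂ w₁ w₂ s → HasFormalCycles G u₁ u₂ w₁ w₂ c 2 →
                 SgnT G F u₁ u₂ w₁ w₂ +
  two⇒positive sgn@(pos _ _) _ = sgn
  two⇒positive sgn@(neg _ _) two = ⊥-elim (joined⇒¬two (negative⇒joined sgn) two)

  one⇒negative : ∀ {s} → SgnT G F u₁ u₂ w₁ w₂ s → HasFormalCycles G u₁ u₂ w₁ w₂ c 1 →
                 SgnT G F u₁ u₂ w₁ w₂ -
  one⇒negative sgn@(neg _ _) _ = sgn
  one⇒negative sgn@(pos _ _) one = ⊥-elim (separated⇒¬one (positive⇒separated sgn) one)

corollary2p4 : ∀ {n m : ℕ} (G : SignedGraph n m) (u₁ u₂ w₁ w₂ : Fin n) →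
    u₁ ≢ u₂ → w₁ ≢ w₂ →
    ∀ (F : Subset m) → Tutte2Arb G u₁ u₂ w₁ w₂ F →
    ∀ (c : Assignment G) → IsReducedContributor G u₁ u₂ w₁ w₂ F c →
    InC1 G u₁ u₂ w₁ w₂ c →
    (SgnT G F u₁ u₂ w₁ w₂ + ⇔ HasFormalCycles G u₁ u₂ w₁ w₂ c 2) ×
    (SgnT G F u₁ u₂ w₁ w₂ - ⇔ HasFormalCycles G u₁ u₂ w₁ w₂ c 1)
corollary2p4 G u₁ u₂ w₁ w₂ u₁≢u₂ _ F ((_ , u₁≁u₂ , _) , _ , sgn) c c-is-cF _ =
    mk⇔ (separated⇒two ∘ positive⇒separated) (two⇒positive sgn)
  , mk⇔ (joined⇒one ∘ negative⇒joined) (one⇒negative sgn)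
  where
    open FormalCycles G u₁ u₂ w₁ w₂ c
    open ReducedContributor G F u₁ u₂ w₁ w₂ c c-is-cF u₁≢u₂ u₁≁u₂
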